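{- For any graphs $G$ and $H$ with no isolated vertex, $$\min\{\rho_o(G)\gamma_{t}(H),\rho_o(H)\gamma_{t}(G)\}\leq \gamma_{R}(G\times H)\leq \min\{2\gamma_t(G)\gamma_{t}(H),6\gamma(G)\gamma(H)\}.$$
   Context: All graphs are finite and simple; $N(v)$ denotes the open neighborhood. The direct product $G\times H$ has vertex set $V(G)\times V(H)$, with $(u,v)$ adjacent to $(u',v')$ iff $uu'\in E(G)$ and $vv'\in E(H)$. $\gamma(G)$ is the domination number (minimum size of a set $S$ with every vertex in $S$ or adjacent to $S$). $\gamma_t(G)$ is the total domination number (minimum size of a set $D$ such that every vertex of $G$ has a neighbor in $D$). An open packing is a set $B$ such that $N(x)\cap N(y)=\emptyset$ for all distinct $x,y\in B$; $\rho_o(G)$ is the maximum size of an open packing. A Roman dominating function on $G$ is $f:V(G)\to\{0,1,2\}$ such that every vertex with value $0$ has a neighbor with value $2$; $\gamma_R(G)$ is the minimum of $\sum_v f(v)$ over such $f$. -}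

module Defs where

open import Data.Nat using (ℕ; _≤_; _*_; _+_)
open import Data.Fin using (Fin; remQuot)
open import Data.Fin.Subset using (Subset; _∈_; ∣_∣)
open import Data.Product using (Σ; ∃; _×_; _,_; proj₁; proj₂)
open import Data.Sum using (_⊎_)
open import Data.Empty using (⊥)
open import Data.Vec using (tabulate; sum)
open import Relation.Nullary using (¬_)
open import Relation.Binary.PropositionalEquality using (_≡_)

record Graph : Set₁ where
  field
    n     : ℕ
    Adj   : Fin n → Fin n → Set
    sym   : ∀ {u v} → Adj u v → Adj v u
    irrfl : ∀ {u} → ¬ Adj u u

open Graph public

NoIsolated : Graph → Set
NoIsolated G = ∀ (v : Fin (n G)) → ∃ λ u → Adj G v u

_×ᵍ_ : Graph → Graph → Graph
G ×ᵍ H = record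
  { n     = n G * n H
  ; Adj   = λ x y → Adj G (proj₁ (remQuot {n G} (n H) x)) (proj₁ (remQuot {n G} (n H) y))
                  × Adj H (proj₂ (remQuot {n G} (n H) x)) (proj₂ (remQuot {n G} (n H) y))
  ; sym   = λ { (a , b) → sym G a , sym H b }
  ; irrfl = λ { (a , b) → irrfl G a }
  }

Dominating : (G : Graph) → Subset (n G) → Set
Dominating G S = ∀ v → v ∈ S ⊎ (∃ λ u → u ∈ S × Adj G v u)

TotalDominating : (G : Graph) → Subset (n G) → Set
TotalDominating G D = ∀ v → ∃ λ u → u ∈ D × Adj G v u

OpenPacking : (G : Graph) → Subset (n G) → Set
OpenPacking G B = ∀ x y → x ∈ B → y ∈ B → ¬ x ≡ y →
                  ∀ z → Adj G x z → Adj G y z → ⊥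

RomanDominating : (G : Graph) → (Fin (n G) → ℕ) → Set
RomanDominating G f =
  (∀ v → f v ≤ 2) ×
  (∀ v → f v ≡ 0 → ∃ λ u → Adj G v u × f u ≡ 2)

weight : (G : Graph) → (Fin (n G) → ℕ) → ℕ
weight G f = sum (tabulate f)

IsDominationNumber : Graph → ℕ → Set
IsDominationNumber G k =
  (Σ (Subset (n G)) λ S → Dominating G S × ∣ S ∣ ≡ k) ×
  (∀ S → Dominating G S → k ≤ ∣ S ∣)

IsTotalDominationNumber : Graph → ℕ → Set
IsTotalDominationNumber G k =
  (Σ (Subset (n G)) λ S → TotalDominating G S × ∣ S ∣ ≡ k) ×
  (∀ S → TotalDominating G S → k ≤ ∣ S ∣)

IsOpenPackingNumber : Graph → ℕ → Set
IsOpenPackingNumber G k =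
  (Σ (Subset (n G)) λ S → OpenPacking G S × ∣ S ∣ ≡ k) ×
  (∀ S → OpenPacking G S → ∣ S ∣ ≤ k)

IsRomanDominationNumber : Graph → ℕ → Set
IsRomanDominationNumber G k =
  (Σ (Fin (n G) → ℕ) λ f → RomanDominating G f × weight G f ≡ k) ×
  (∀ f → RomanDominating G f → k ≤ weight G f)

-- Upper bounds: if S dominates a graph then twice its indicator is a Roman dominating
-- function, of weight 2|S|. For total dominating sets D_G, D_H the product D_G × D_H totally
-- dominates G × H; for dominating sets S, T the set S × T ∪ S × N(T) ∪ N(S) × T dominates
-- G × H, where N maps each vertex to one chosen neighbour, and it has at most 3|S||T| elements.
-- Lower bound: let f be a Roman dominating function on G × H and B an open packing of G. For
-- b ∈ B, the H-coordinates of the weight-2 guards of the zeros of row b, together with one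
-- neighbour of each nonzero vertex of row b, totally dominate H. These guards lie in V₂ and
-- their G-coordinates are neighbours of b, so rows of the open packing have disjoint guard
-- sets; summing over B gives |B| γt(H) ≤ |V₂| + |V₁ ∪ V₂| ≤ w(f).
module Submission where

open import Level using (Level)
open import Data.Bool using (true)
open import Data.Empty using (⊥-elim)
open import Data.Fin using (Fin; zero; suc; combine; remQuot; _↑ˡ_; _↑ʳ_)
import Data.Fin.Properties as Finₚ
open Finₚ using (any?; remQuot-combine)
open import Data.Fin.Subset using (Subset; _∈_; _∪_; ∣_∣; inside; outside)
open import Data.Fin.Subset.Properties using (_∈?_; drop-there; p⊆p∪q; q⊆p∪q; x∈p∪q⁻)
open import Data.Nat using (ℕ; zero; suc; _+_; _*_; _≤_; _⊓_; z≤n; s≤s; _≟_)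
open import Data.Nat.Properties
open import Algebra.Properties.Semiring.Sum +-*-semiring
  using (sum; sum-syntax; sum-cong-≗; sum-replicate-zero; ∑-distrib-+; ∑-comm;
         *-distribˡ-sum; *-distribʳ-sum)
open import Data.Nat.Tactic.RingSolver using (solve-∀)
open import Data.Product using (_×_; _,_; proj₁; proj₂; ∃)
open import Data.Sum using (_⊎_; inj₁; inj₂)
open import Data.Vec using ([]; _∷_; tabulate; there)
import Data.Vec as Vec
open import Data.Vec.Properties using (lookup∘tabulate; lookup⇒[]=; []=⇒lookup)
open import Function using (_∘_)
open import Relation.Binary.PropositionalEquality
open import Relation.Nullary using (Dec; yes; no; does; ¬_)
open import Relation.Nullary.Decidable using (_×-dec_; ¬?; dec-true)
open import Relation.Unary using (Pred; Decidable)

open import Defs hiding (sym)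

private variable
  a b c ℓ : Level
  A : Set a
  B : Set b
  C : Set c
  k m : ℕ

-- Counting on finite sets

χ : Dec A → ℕ
χ (yes _) = 1
χ (no _)  = 0

χ≤1 : (d : Dec A) → χ d ≤ 1
χ≤1 (yes _) = ≤-refl
χ≤1 (no _)  = z≤n

χ-yes : (d : Dec A) → A → χ d ≡ 1
χ-yes (yes _) _  = refl
χ-yes (no ¬a) a  = ⊥-elim (¬a a)

χ-no : (d : Dec A) → ¬ A → χ d ≡ 0
χ-no (yes a) ¬a = ⊥-elim (¬a a)
χ-no (no _)  _  = refl

χ-mono : (dA : Dec A) (dB : Dec B) → (A → B) → χ dA ≤ χ dB
χ-mono (yes a) dB f = ≤-reflexive (sym (χ-yes dB (f a)))
χ-mono (no _)  dB f = z≤n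

χ-cong : (dA : Dec A) (dB : Dec B) → (A → B) → (B → A) → χ dA ≡ χ dB
χ-cong dA dB f g = ≤-antisym (χ-mono dA dB f) (χ-mono dB dA g)

χ-⊎ : (dA : Dec A) (dB : Dec B) (dC : Dec C) → (A → B ⊎ C) → χ dA ≤ χ dB + χ dC
χ-⊎ (no _)  dB dC split = z≤n
χ-⊎ (yes a) dB dC split with split a
... | inj₁ b = ≤-trans (≤-reflexive (sym (χ-yes dB b))) (m≤m+n (χ dB) (χ dC))
... | inj₂ c = ≤-trans (≤-reflexive (sym (χ-yes dC c))) (m≤n+m (χ dC) (χ dB))

χ-×-dec : (dA : Dec A) (dB : Dec B) → χ (dA ×-dec dB) ≡ χ dA * χ dB
χ-×-dec (yes _) (yes _) = refl
χ-×-dec (yes _) (no _)  = refl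
χ-×-dec (no _)  (yes _) = refl
χ-×-dec (no _)  (no _)  = refl

χ-≡2+χ-≢0≤ : ∀ y → y ≤ 2 → χ (y ≟ 2) + χ (¬? (y ≟ 0)) ≤ y
χ-≡2+χ-≢0≤ 0 _ = z≤n
χ-≡2+χ-≢0≤ 1 _ = ≤-refl
χ-≡2+χ-≢0≤ 2 _ = ≤-refl
χ-≡2+χ-≢0≤ (suc (suc (suc _))) (s≤s (s≤s ()))

∑-mono-≤ : {f g : Fin k → ℕ} → (∀ i → f i ≤ g i) → sum f ≤ sum g
∑-mono-≤ {zero}  _   = z≤n
∑-mono-≤ {suc k} f≤g = +-mono-≤ (f≤g zero) (∑-mono-≤ (f≤g ∘ suc))

∑-≡0 : {f : Fin k → ℕ} → (∀ i → f i ≡ 0) → sum f ≡ 0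
∑-≡0 {k} f≡0 = trans (sum-cong-≗ f≡0) (sum-replicate-zero k)

summand≤∑ : (f : Fin k → ℕ) (i : Fin k) → f i ≤ sum f
summand≤∑ f zero    = m≤m+n (f zero) _
summand≤∑ f (suc i) = ≤-trans (summand≤∑ (f ∘ suc) i) (m≤n+m _ (f zero))

∑-↑ : ∀ m k (h : Fin (m + k) → ℕ) →
      sum h ≡ ∑[ i < m ] h (i ↑ˡ k) + ∑[ j < k ] h (m ↑ʳ j)
∑-↑ zero    k h = refl
∑-↑ (suc m) k h = trans (cong (h zero +_) (∑-↑ m k (h ∘ suc))) (sym (+-assoc (h zero) _ _))

∑-combine : ∀ m k (h : Fin (m * k) → ℕ) → sum h ≡ ∑[ i < m ] ∑[ j < k ] h (combine i j)
∑-combine zero    k h = refl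
∑-combine (suc m) k h =
  trans (∑-↑ k (m * k) h) (cong (sum (λ j → h (j ↑ˡ m * k)) +_) (∑-combine m k (h ∘ (k ↑ʳ_))))

∑*∑ : (p : Fin m → ℕ) (q : Fin k → ℕ) → sum p * sum q ≡ ∑[ i < m ] ∑[ j < k ] (p i * q j)
∑*∑ p q = trans (*-distribʳ-sum (sum q) p) (sum-cong-≗ (λ i → *-distribˡ-sum (p i) q))

sum-tabulate : (f : Fin k → ℕ) → Vec.sum (tabulate f) ≡ sum f
sum-tabulate {zero}  f = refl
sum-tabulate {suc k} f = cong (f zero +_) (sum-tabulate (f ∘ suc))

∑χ≤1 : {P : Pred (Fin k) ℓ} (P? : Decidable P) →
       (∀ {i j} → P i → P j → i ≡ j) → ∑[ i < k ] χ (P? i) ≤ 1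
∑χ≤1 {zero}  P? unique = z≤n
∑χ≤1 {suc k} P? unique with P? zero
... | yes p = s≤s (≤-reflexive (∑-≡0 (λ i → χ-no (P? (suc i)) (Finₚ.0≢1+n ∘ unique p))))
... | no _  = ∑χ≤1 (P? ∘ suc) (λ p q → Finₚ.suc-injective (unique p q))

module _ {P : Pred (Fin k) ℓ} (P? : Decidable P) where

  ∑χ≤χ∃ : (∀ {i j} → P i → P j → i ≡ j) → ∑[ i < k ] χ (P? i) ≤ χ (any? P?)
  ∑χ≤χ∃ unique with any? P?
  ... | yes _ = ∑χ≤1 P? unique
  ... | no ∄  = ≤-reflexive (∑-≡0 (λ i → χ-no (P? i) (λ p → ∄ (i , p))))

  χ∃≤∑χ : χ (any? P?) ≤ ∑[ i < k ] χ (P? i)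
  χ∃≤∑χ with any? P?
  ... | yes (i , p) = ≤-trans (≤-reflexive (sym (χ-yes (P? i) p))) (summand≤∑ (χ ∘ P?) i)
  ... | no _        = z≤n

χ-∈-there : ∀ x (p : Subset k) i → χ (suc i ∈? x ∷ p) ≡ χ (i ∈? p)
χ-∈-there x p i = χ-cong (suc i ∈? x ∷ p) (i ∈? p) drop-there there

∣p∣≡∑χ∈ : (p : Subset k) → ∣ p ∣ ≡ ∑[ i < k ] χ (i ∈? p)
∣p∣≡∑χ∈ []            = refl
∣p∣≡∑χ∈ (inside ∷ p)  = cong suc (trans (∣p∣≡∑χ∈ p) (sum-cong-≗ (sym ∘ χ-∈-there inside p)))
∣p∣≡∑χ∈ (outside ∷ p) = trans (∣p∣≡∑χ∈ p) (sum-cong-≗ (sym ∘ χ-∈-there outside p))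

∣p∪q∣≤∣p∣+∣q∣ : (p q : Subset k) → ∣ p ∪ q ∣ ≤ ∣ p ∣ + ∣ q ∣
∣p∪q∣≤∣p∣+∣q∣ {k} p q = begin
  ∣ p ∪ q ∣                                     ≡⟨ ∣p∣≡∑χ∈ (p ∪ q) ⟩
  ∑[ i < k ] χ (i ∈? p ∪ q)                     ≤⟨ ∑-mono-≤ (λ i → χ-⊎ (i ∈? p ∪ q) (i ∈? p) (i ∈? q) (x∈p∪q⁻ p q)) ⟩
  ∑[ i < k ] (χ (i ∈? p) + χ (i ∈? q))          ≡⟨ ∑-distrib-+ (λ i → χ (i ∈? p)) (λ i → χ (i ∈? q)) ⟩
  ∑[ i < k ] χ (i ∈? p) + ∑[ i < k ] χ (i ∈? q) ≡⟨ sym (cong₂ _+_ (∣p∣≡∑χ∈ p) (∣p∣≡∑χ∈ q)) ⟩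
  ∣ p ∣ + ∣ q ∣                                 ∎
  where open ≤-Reasoning

⟦_⟧ : {P : Pred (Fin k) ℓ} → Decidable P → Subset k
⟦ P? ⟧ = tabulate (does ∘ P?)

module _ {P : Pred (Fin k) ℓ} (P? : Decidable P) where

  ∈⟦⟧⁺ : ∀ {i} → P i → i ∈ ⟦ P? ⟧
  ∈⟦⟧⁺ {i} p = lookup⇒[]= i _ (trans (lookup∘tabulate _ i) (dec-true (P? i) p))

  ∈⟦⟧⁻ : ∀ {i} → i ∈ ⟦ P? ⟧ → P i
  ∈⟦⟧⁻ {i} i∈ = does-true (P? i) (trans (sym (lookup∘tabulate _ i)) ([]=⇒lookup i∈))
    where
    does-true : (d : Dec A) → does d ≡ true → A
    does-true (yes a) _ = a

  ∣⟦⟧∣ : ∣ ⟦ P? ⟧ ∣ ≡ ∑[ i < k ] χ (P? i)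
  ∣⟦⟧∣ = trans (∣p∣≡∑χ∈ ⟦ P? ⟧) (sum-cong-≗ (λ i → χ-cong (i ∈? ⟦ P? ⟧) (P? i) ∈⟦⟧⁻ ∈⟦⟧⁺))

module _ (φ : Fin m → Fin k) (S : Subset m) where

  private
    hit? : ∀ v w → Dec (v ∈ S × φ v ≡ w)
    hit? v w = (v ∈? S) ×-dec (φ v Finₚ.≟ w)

    hit-any? : ∀ w → Dec (∃ λ v → v ∈ S × φ v ≡ w)
    hit-any? w = any? (λ v → hit? v w)

  image : Subset k
  image = ⟦ hit-any? ⟧

  ∈-image⁺ : ∀ {v} → v ∈ S → φ v ∈ image
  ∈-image⁺ {v} v∈S = ∈⟦⟧⁺ hit-any? (v , v∈S , refl)

  ∈-image⁻ : ∀ {w} → w ∈ image → ∃ λ v → v ∈ S × φ v ≡ w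
  ∈-image⁻ = ∈⟦⟧⁻ hit-any?

  ∣image∣≤∣p∣ : ∣ image ∣ ≤ ∣ S ∣
  ∣image∣≤∣p∣ = begin
    ∣ image ∣                          ≡⟨ ∣⟦⟧∣ hit-any? ⟩
    ∑[ w < k ] χ (hit-any? w)          ≤⟨ ∑-mono-≤ (λ w → χ∃≤∑χ (λ v → hit? v w)) ⟩
    ∑[ w < k ] ∑[ v < m ] χ (hit? v w) ≡⟨ ∑-comm (λ w v → χ (hit? v w)) ⟩
    ∑[ v < m ] ∑[ w < k ] χ (hit? v w) ≤⟨ ∑-mono-≤ (λ v → ∑χ≤χ∃ (hit? v) (λ (_ , e) (_ , e′) → trans (sym e) e′)) ⟩
    ∑[ v < m ] χ (any? (hit? v))       ≤⟨ ∑-mono-≤ (λ v → χ-mono (any? (hit? v)) (v ∈? S) (proj₁ ∘ proj₂)) ⟩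
    ∑[ v < m ] χ (v ∈? S)              ≡⟨ sym (∣p∣≡∑χ∈ S) ⟩
    ∣ S ∣                              ∎
    where open ≤-Reasoning

∑χ*∣∣≤∣∣ : (I : Subset m) (A : Fin m → Subset k) (C : Subset k) →
           (∀ {i j x} → i ∈ I → j ∈ I → x ∈ A i → x ∈ A j → i ≡ j) →
           (∀ {i x} → i ∈ I → x ∈ A i → x ∈ C) →
           ∑[ i < m ] (χ (i ∈? I) * ∣ A i ∣) ≤ ∣ C ∣
∑χ*∣∣≤∣∣ {m} {k} I A C disjoint A⊆C = begin
  ∑[ i < m ] (χ (i ∈? I) * ∣ A i ∣)                  ≡⟨ sum-cong-≗ (λ i → cong (χ (i ∈? I) *_) (∣p∣≡∑χ∈ (A i))) ⟩
  ∑[ i < m ] (χ (i ∈? I) * ∑[ x < k ] χ (x ∈? A i))  ≡⟨ sum-cong-≗ (λ i → *-distribˡ-sum (χ (i ∈? I)) (λ x → χ (x ∈? A i))) ⟩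
  ∑[ i < m ] ∑[ x < k ] (χ (i ∈? I) * χ (x ∈? A i))  ≡⟨ sum-cong-≗ (λ i → sum-cong-≗ (λ x → sym (χ-×-dec (i ∈? I) (x ∈? A i)))) ⟩
  ∑[ i < m ] ∑[ x < k ] χ (member? x i)              ≡⟨ ∑-comm (λ i x → χ (member? x i)) ⟩
  ∑[ x < k ] ∑[ i < m ] χ (member? x i)              ≤⟨ ∑-mono-≤ (λ x → ∑χ≤χ∃ (member? x) λ (i∈ , x∈) (j∈ , x∈′) → disjoint i∈ j∈ x∈ x∈′) ⟩
  ∑[ x < k ] χ (any? (member? x))                    ≤⟨ ∑-mono-≤ (λ x → χ-mono (any? (member? x)) (x ∈? C) (λ (_ , i∈ , x∈) → A⊆C i∈ x∈)) ⟩
  ∑[ x < k ] χ (x ∈? C)                              ≡⟨ sym (∣p∣≡∑χ∈ C) ⟩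
  ∣ C ∣                                              ∎
  where
  open ≤-Reasoning
  member? : ∀ x i → Dec (i ∈ I × x ∈ A i)
  member? x i = (i ∈? I) ×-dec (x ∈? A i)

module Coordinates (m k : ℕ) where

  π₁ : Fin (m * k) → Fin m
  π₁ x = proj₁ (remQuot {m} k x)

  π₂ : Fin (m * k) → Fin k
  π₂ x = proj₂ (remQuot {m} k x)

  π₁-combine : ∀ i j → π₁ (combine {m} i j) ≡ i
  π₁-combine i j = cong proj₁ (remQuot-combine {m} i j)

  π₂-combine : ∀ i j → π₂ (combine {m} i j) ≡ j
  π₂-combine i j = cong proj₂ (remQuot-combine {m} i j)

  ∑-π : (h : Fin m → Fin k → ℕ) → ∑[ x < m * k ] h (π₁ x) (π₂ x) ≡ ∑[ i < m ] ∑[ j < k ] h i j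
  ∑-π h = trans (∑-combine m k _)
                (sum-cong-≗ (λ i → sum-cong-≗ (λ j → cong₂ h (π₁-combine i j) (π₂-combine i j))))

  infixr 7 _⊠_
  _⊠_ : Subset m → Subset k → Subset (m * k)
  S ⊠ T = ⟦ (λ x → (π₁ x ∈? S) ×-dec (π₂ x ∈? T)) ⟧

  ∈-⊠⁺ : ∀ {S T x} → π₁ x ∈ S → π₂ x ∈ T → x ∈ S ⊠ T
  ∈-⊠⁺ {S} {T} p q = ∈⟦⟧⁺ (λ x → (π₁ x ∈? S) ×-dec (π₂ x ∈? T)) (p , q)

  combine-∈-⊠ : ∀ {S T i j} → i ∈ S → j ∈ T → combine i j ∈ S ⊠ T
  combine-∈-⊠ {S} {T} {i} {j} i∈S j∈T =
    ∈-⊠⁺ (subst (_∈ S) (sym (π₁-combine i j)) i∈S) (subst (_∈ T) (sym (π₂-combine i j)) j∈T)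

  ∣⊠∣ : ∀ S T → ∣ S ⊠ T ∣ ≡ ∣ S ∣ * ∣ T ∣
  ∣⊠∣ S T = begin
    ∣ S ⊠ T ∣                                               ≡⟨ ∣⟦⟧∣ (λ x → (π₁ x ∈? S) ×-dec (π₂ x ∈? T)) ⟩
    ∑[ x < m * k ] χ ((π₁ x ∈? S) ×-dec (π₂ x ∈? T))        ≡⟨ ∑-π (λ i j → χ ((i ∈? S) ×-dec (j ∈? T))) ⟩
    ∑[ i < m ] ∑[ j < k ] χ ((i ∈? S) ×-dec (j ∈? T))       ≡⟨ sum-cong-≗ (λ i → sum-cong-≗ (λ j → χ-×-dec (i ∈? S) (j ∈? T))) ⟩
    ∑[ i < m ] ∑[ j < k ] (χ (i ∈? S) * χ (j ∈? T))         ≡⟨ sym (∑*∑ (λ i → χ (i ∈? S)) (λ j → χ (j ∈? T))) ⟩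
    ∑[ i < m ] χ (i ∈? S) * ∑[ j < k ] χ (j ∈? T)           ≡⟨ sym (cong₂ _*_ (∣p∣≡∑χ∈ S) (∣p∣≡∑χ∈ T)) ⟩
    ∣ S ∣ * ∣ T ∣                                           ∎
    where open ≡-Reasoning

-- Upper bounds

module _ (G : Graph) {S : Subset (n G)} (S-dom : Dominating G S) where

  twiceOn : Fin (n G) → ℕ
  twiceOn v = 2 * χ (v ∈? S)

  romanDominating-twiceOn : RomanDominating G twiceOn
  romanDominating-twiceOn = (λ v → *-monoʳ-≤ 2 (χ≤1 (v ∈? S))) , defended
    where
    defended : ∀ v → twiceOn v ≡ 0 → ∃ λ u → Adj G v u × twiceOn u ≡ 2
    defended v 2χ≡0 with S-dom v
    ... | inj₁ v∈S           = ⊥-elim (0≢1+n (trans (sym 2χ≡0) (cong (2 *_) (χ-yes (v ∈? S) v∈S))))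
    ... | inj₂ (u , u∈S , vu) = u , vu , cong (2 *_) (χ-yes (u ∈? S) u∈S)

  weight-twiceOn : weight G twiceOn ≡ 2 * ∣ S ∣
  weight-twiceOn = begin
    weight G twiceOn                 ≡⟨ sum-tabulate twiceOn ⟩
    ∑[ v < n G ] (2 * χ (v ∈? S))    ≡⟨ sym (*-distribˡ-sum 2 (λ v → χ (v ∈? S))) ⟩
    2 * ∑[ v < n G ] χ (v ∈? S)      ≡⟨ cong (2 *_) (sym (∣p∣≡∑χ∈ S)) ⟩
    2 * ∣ S ∣                        ∎
    where open ≡-Reasoning

  roman≤2*∣dominating∣ : ∀ {γR} → IsRomanDominationNumber G γR → γR ≤ 2 * ∣ S ∣
  roman≤2*∣dominating∣ (_ , minimal) =
    ≤-trans (minimal twiceOn romanDominating-twiceOn) (≤-reflexive weight-twiceOn)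

totalDominating⇒dominating : (G : Graph) {S : Subset (n G)} → TotalDominating G S → Dominating G S
totalDominating⇒dominating G tdS v = inj₂ (tdS v)

partner : (G : Graph) → NoIsolated G → Fin (n G) → Fin (n G)
partner G noG v = proj₁ (noG v)

module _ (G H : Graph) where

  open Coordinates (n G) (n H)

  Adj-combine : ∀ {x a w} → Adj G (π₁ x) a → Adj H (π₂ x) w → Adj (G ×ᵍ H) x (combine a w)
  Adj-combine {x} {a} {w} xa xw =
    subst (Adj G (π₁ x)) (sym (π₁-combine a w)) xa , subst (Adj H (π₂ x)) (sym (π₂-combine a w)) xw

  totalDominating-⊠ : ∀ {S T} → TotalDominating G S → TotalDominating H T →
                      TotalDominating (G ×ᵍ H) (S ⊠ T)
  totalDominating-⊠ tdS tdT x with tdS (π₁ x) | tdT (π₂ x)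
  ... | a , a∈S , xa | w , w∈T , xw = combine a w , combine-∈-⊠ a∈S w∈T , Adj-combine xa xw

  roman≤2*γt*γt : ∀ {γR S T} → IsRomanDominationNumber (G ×ᵍ H) γR →
                  TotalDominating G S → TotalDominating H T → γR ≤ 2 * ∣ S ∣ * ∣ T ∣
  roman≤2*γt*γt {γR} {S} {T} γR-min tdS tdT = begin
    γR                 ≤⟨ roman≤2*∣dominating∣ (G ×ᵍ H) S⊠T-dom γR-min ⟩
    2 * ∣ S ⊠ T ∣      ≡⟨ cong (2 *_) (∣⊠∣ S T) ⟩
    2 * (∣ S ∣ * ∣ T ∣) ≡⟨ sym (*-assoc 2 ∣ S ∣ ∣ T ∣) ⟩
    2 * ∣ S ∣ * ∣ T ∣   ∎
    where
    open ≤-Reasoning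
    S⊠T-dom : Dominating (G ×ᵍ H) (S ⊠ T)
    S⊠T-dom = totalDominating⇒dominating (G ×ᵍ H) (totalDominating-⊠ tdS tdT)

  module _ (noG : NoIsolated G) (noH : NoIsolated H) (S : Subset (n G)) (T : Subset (n H)) where

    productDominator : Subset (n G * n H)
    productDominator = (S ⊠ T ∪ S ⊠ image (partner H noH) T) ∪ image (partner G noG) S ⊠ T

    dominating-productDominator : Dominating G S → Dominating H T → Dominating (G ×ᵍ H) productDominator
    dominating-productDominator domS domT x with domS (π₁ x) | domT (π₂ x)
    ... | inj₁ a∈S | inj₁ w∈T = inj₁ (p⊆p∪q _ (p⊆p∪q _ (∈-⊠⁺ a∈S w∈T)))
    ... | inj₁ a∈S | inj₂ (w , w∈T , xw) =
      inj₂ (combine (partner G noG (π₁ x)) w ,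
            q⊆p∪q _ _ (combine-∈-⊠ (∈-image⁺ (partner G noG) S a∈S) w∈T) ,
            Adj-combine (proj₂ (noG (π₁ x))) xw)
    ... | inj₂ (a , a∈S , xa) | inj₁ w∈T =
      inj₂ (combine a (partner H noH (π₂ x)) ,
            p⊆p∪q _ (q⊆p∪q _ _ (combine-∈-⊠ a∈S (∈-image⁺ (partner H noH) T w∈T))) ,
            Adj-combine xa (proj₂ (noH (π₂ x))))
    ... | inj₂ (a , a∈S , xa) | inj₂ (w , w∈T , xw) =
      inj₂ (combine a w , p⊆p∪q _ (p⊆p∪q _ (combine-∈-⊠ a∈S w∈T)) , Adj-combine xa xw)

    ∣productDominator∣≤ : ∣ productDominator ∣ ≤ 3 * (∣ S ∣ * ∣ T ∣)
    ∣productDominator∣≤ = begin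
      ∣ productDominator ∣
        ≤⟨ ∣p∪q∣≤∣p∣+∣q∣ (S ⊠ T ∪ S ⊠ NT) (NS ⊠ T) ⟩
      ∣ S ⊠ T ∪ S ⊠ NT ∣ + ∣ NS ⊠ T ∣
        ≤⟨ +-monoˡ-≤ ∣ NS ⊠ T ∣ (∣p∪q∣≤∣p∣+∣q∣ (S ⊠ T) (S ⊠ NT)) ⟩
      ∣ S ⊠ T ∣ + ∣ S ⊠ NT ∣ + ∣ NS ⊠ T ∣
        ≡⟨ cong₂ _+_ (cong₂ _+_ (∣⊠∣ S T) (∣⊠∣ S NT)) (∣⊠∣ NS T) ⟩
      ∣ S ∣ * ∣ T ∣ + ∣ S ∣ * ∣ NT ∣ + ∣ NS ∣ * ∣ T ∣
        ≤⟨ +-mono-≤ (+-monoʳ-≤ (∣ S ∣ * ∣ T ∣) (*-monoʳ-≤ ∣ S ∣ (∣image∣≤∣p∣ (partner H noH) T)))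
                    (*-monoˡ-≤ ∣ T ∣ (∣image∣≤∣p∣ (partner G noG) S)) ⟩
      ∣ S ∣ * ∣ T ∣ + ∣ S ∣ * ∣ T ∣ + ∣ S ∣ * ∣ T ∣
        ≡⟨ thrice (∣ S ∣ * ∣ T ∣) ⟩
      3 * (∣ S ∣ * ∣ T ∣)
        ∎
      where
      open ≤-Reasoning
      NS = image (partner G noG) S
      NT = image (partner H noH) T
      thrice : ∀ x → x + x + x ≡ 3 * x
      thrice = solve-∀

  roman≤6*γ*γ : NoIsolated G → NoIsolated H → ∀ {γR S T} → IsRomanDominationNumber (G ×ᵍ H) γR →
                Dominating G S → Dominating H T → γR ≤ 6 * ∣ S ∣ * ∣ T ∣
  roman≤6*γ*γ noG noH {γR} {S} {T} γR-min domS domT = begin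
    γR                           ≤⟨ roman≤2*∣dominating∣ (G ×ᵍ H) D-dom γR-min ⟩
    2 * ∣ D ∣                    ≤⟨ *-monoʳ-≤ 2 (∣productDominator∣≤ noG noH S T) ⟩
    2 * (3 * (∣ S ∣ * ∣ T ∣))    ≡⟨ reassociate ∣ S ∣ ∣ T ∣ ⟩
    6 * ∣ S ∣ * ∣ T ∣            ∎
    where
    open ≤-Reasoning
    D = productDominator noG noH S T
    D-dom = dominating-productDominator noG noH S T domS domT
    reassociate : ∀ s t → 2 * (3 * (s * t)) ≡ 6 * s * t
    reassociate = solve-∀

  -- Lower bound

  module _ (noH : NoIsolated H) {f : Fin (n G * n H) → ℕ} (rd : RomanDominating (G ×ᵍ H) f) where

    -- guard x is meaningful only when f x ≡ 0.
    guard : Fin (n G * n H) → Fin (n G * n H)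
    guard x with f x ≟ 0
    ... | yes fx≡0 = proj₁ (proj₂ rd x fx≡0)
    ... | no _     = x

    guard-defends : ∀ x → f x ≡ 0 → Adj (G ×ᵍ H) x (guard x) × f (guard x) ≡ 2
    guard-defends x fx≡0 with f x ≟ 0
    ... | yes fx≡0′ = proj₂ (proj₂ rd x fx≡0′)
    ... | no fx≢0   = ⊥-elim (fx≢0 fx≡0)

    zeroAt? : (b : Fin (n G)) (v : Fin (n H)) → Dec (f (combine b v) ≡ 0)
    zeroAt? b v = f (combine b v) ≟ 0

    zerosIn nonzerosIn : Fin (n G) → Subset (n H)
    zerosIn    b = ⟦ zeroAt? b ⟧
    nonzerosIn b = ⟦ ¬? ∘ zeroAt? b ⟧

    guardsOf : Fin (n G) → Subset (n G * n H)
    guardsOf b = image (guard ∘ combine b) (zerosIn b)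

    guardsOf-spec : ∀ {b x} → x ∈ guardsOf b → Adj G b (π₁ x) × f x ≡ 2
    guardsOf-spec {b} x∈ with ∈-image⁻ (guard ∘ combine b) (zerosIn b) x∈
    ... | v , v∈ , refl with guard-defends (combine b v) (∈⟦⟧⁻ (zeroAt? b) v∈)
    ... | (adjG , _) , two = subst (λ a → Adj G a (π₁ (guard (combine b v)))) (π₁-combine b v) adjG , two

    rowDominator : Fin (n G) → Subset (n H)
    rowDominator b = image π₂ (guardsOf b) ∪ image (partner H noH) (nonzerosIn b)

    totalDominating-row : ∀ b → TotalDominating H (rowDominator b)
    totalDominating-row b v with f (combine b v) ≟ 0
    ... | yes z =
      π₂ (guard (combine b v)) ,
      p⊆p∪q _ (∈-image⁺ π₂ (guardsOf b) (∈-image⁺ (guard ∘ combine b) (zerosIn b) (∈⟦⟧⁺ (zeroAt? b) z))) ,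
      subst (λ w → Adj H w (π₂ (guard (combine b v)))) (π₂-combine b v)
            (proj₂ (proj₁ (guard-defends (combine b v) z)))
    ... | no nz =
      partner H noH v ,
      q⊆p∪q _ _ (∈-image⁺ (partner H noH) (nonzerosIn b) (∈⟦⟧⁺ (¬? ∘ zeroAt? b) nz)) ,
      proj₂ (noH v)

    ∣rowDominator∣≤ : ∀ b → ∣ rowDominator b ∣ ≤ ∣ guardsOf b ∣ + ∣ nonzerosIn b ∣
    ∣rowDominator∣≤ b =
      ≤-trans (∣p∪q∣≤∣p∣+∣q∣ (image π₂ (guardsOf b)) (image (partner H noH) (nonzerosIn b)))
              (+-mono-≤ (∣image∣≤∣p∣ π₂ (guardsOf b)) (∣image∣≤∣p∣ (partner H noH) (nonzerosIn b)))

    twos nonzeros : Subset (n G * n H)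
    twos     = ⟦ (λ x → f x ≟ 2) ⟧
    nonzeros = ⟦ (λ x → ¬? (f x ≟ 0)) ⟧

    -- An open packing B makes the guard sets of its rows pairwise disjoint.
    ∑∣guardsOf∣≤∣twos∣ : ∀ {B} → OpenPacking G B → ∑[ b < n G ] (χ (b ∈? B) * ∣ guardsOf b ∣) ≤ ∣ twos ∣
    ∑∣guardsOf∣≤∣twos∣ {B} opB =
      ∑χ*∣∣≤∣∣ B guardsOf twos disjoint (λ _ x∈ → ∈⟦⟧⁺ (λ x → f x ≟ 2) (proj₂ (guardsOf-spec x∈)))
      where
      disjoint : ∀ {i j x} → i ∈ B → j ∈ B → x ∈ guardsOf i → x ∈ guardsOf j → i ≡ j
      disjoint {i} {j} {x} i∈B j∈B x∈i x∈j with i Finₚ.≟ j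
      ... | yes i≡j = i≡j
      ... | no i≢j  =
        ⊥-elim (opB i j i∈B j∈B i≢j (π₁ x) (proj₁ (guardsOf-spec x∈i)) (proj₁ (guardsOf-spec x∈j)))

    ∑∣nonzerosIn∣≡∣nonzeros∣ : ∑[ b < n G ] ∣ nonzerosIn b ∣ ≡ ∣ nonzeros ∣
    ∑∣nonzerosIn∣≡∣nonzeros∣ = begin
      ∑[ b < n G ] ∣ nonzerosIn b ∣                                  ≡⟨ sum-cong-≗ {x = λ b → ∣ nonzerosIn b ∣} (λ b → ∣⟦⟧∣ (¬? ∘ zeroAt? b)) ⟩
      ∑[ b < n G ] ∑[ v < n H ] χ (¬? (f (combine b v) ≟ 0))         ≡⟨ sym (∑-combine (n G) (n H) (λ x → χ (¬? (f x ≟ 0)))) ⟩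
      ∑[ x < n G * n H ] χ (¬? (f x ≟ 0))                            ≡⟨ sym (∣⟦⟧∣ (λ x → ¬? (f x ≟ 0))) ⟩
      ∣ nonzeros ∣                                                   ∎
      where open ≡-Reasoning

    ∣twos∣+∣nonzeros∣≤weight : ∣ twos ∣ + ∣ nonzeros ∣ ≤ weight (G ×ᵍ H) f
    ∣twos∣+∣nonzeros∣≤weight = begin
      ∣ twos ∣ + ∣ nonzeros ∣
        ≡⟨ cong₂ _+_ (∣⟦⟧∣ (λ x → f x ≟ 2)) (∣⟦⟧∣ (λ x → ¬? (f x ≟ 0))) ⟩
      ∑[ x < n G * n H ] χ (f x ≟ 2) + ∑[ x < n G * n H ] χ (¬? (f x ≟ 0))
        ≡⟨ sym (∑-distrib-+ (λ x → χ (f x ≟ 2)) (λ x → χ (¬? (f x ≟ 0)))) ⟩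
      ∑[ x < n G * n H ] (χ (f x ≟ 2) + χ (¬? (f x ≟ 0)))
        ≤⟨ ∑-mono-≤ (λ x → χ-≡2+χ-≢0≤ (f x) (proj₁ rd x)) ⟩
      sum f
        ≡⟨ sym (sum-tabulate f) ⟩
      weight (G ×ᵍ H) f
        ∎
      where open ≤-Reasoning

    ∣B∣*γt≤weight : ∀ {B γt} → OpenPacking G B → (∀ T → TotalDominating H T → γt ≤ ∣ T ∣) →
                    ∣ B ∣ * γt ≤ weight (G ×ᵍ H) f
    ∣B∣*γt≤weight {B} {γt} opB γt-min = begin
      ∣ B ∣ * γt                                                   ≡⟨ cong (_* γt) (∣p∣≡∑χ∈ B) ⟩
      ∑[ b < n G ] χ (b ∈? B) * γt                                 ≡⟨ *-distribʳ-sum γt (λ b → χ (b ∈? B)) ⟩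
      ∑[ b < n G ] (χ (b ∈? B) * γt)                               ≤⟨ ∑-mono-≤ rowBound ⟩
      ∑[ b < n G ] (χ (b ∈? B) * ∣ guardsOf b ∣ + ∣ nonzerosIn b ∣) ≡⟨ ∑-distrib-+ (λ b → χ (b ∈? B) * ∣ guardsOf b ∣) (λ b → ∣ nonzerosIn b ∣) ⟩
      ∑[ b < n G ] (χ (b ∈? B) * ∣ guardsOf b ∣) + ∑[ b < n G ] ∣ nonzerosIn b ∣
        ≤⟨ +-mono-≤ (∑∣guardsOf∣≤∣twos∣ opB) (≤-reflexive ∑∣nonzerosIn∣≡∣nonzeros∣) ⟩
      ∣ twos ∣ + ∣ nonzeros ∣                                      ≤⟨ ∣twos∣+∣nonzeros∣≤weight ⟩
      weight (G ×ᵍ H) f                                            ∎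
      where
      open ≤-Reasoning
      rowBound : ∀ b → χ (b ∈? B) * γt ≤ χ (b ∈? B) * ∣ guardsOf b ∣ + ∣ nonzerosIn b ∣
      rowBound b = begin
        δ * γt          ≤⟨ *-monoʳ-≤ δ (≤-trans (γt-min _ (totalDominating-row b)) (∣rowDominator∣≤ b)) ⟩
        δ * (g + z)     ≡⟨ *-distribˡ-+ δ g z ⟩
        δ * g + δ * z   ≤⟨ +-monoʳ-≤ (δ * g) (≤-trans (*-monoˡ-≤ z (χ≤1 (b ∈? B))) (≤-reflexive (*-identityˡ z))) ⟩
        δ * g + z       ∎
        where
        δ = χ (b ∈? B)
        g = ∣ guardsOf b ∣
        z = ∣ nonzerosIn b ∣

theorem2p5 : (G H : Graph) → NoIsolated G → NoIsolated H →
    (γG γH γtG γtH ρG ρH γR : ℕ) →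
    IsDominationNumber G γG → IsDominationNumber H γH →
    IsTotalDominationNumber G γtG → IsTotalDominationNumber H γtH →
    IsOpenPackingNumber G ρG → IsOpenPackingNumber H ρH →
    IsRomanDominationNumber (G ×ᵍ H) γR →
    ((ρG * γtH) ⊓ (ρH * γtG) ≤ γR) ×
    (γR ≤ (2 * γtG * γtH) ⊓ (6 * γG * γH))
theorem2p5 G H noG noH γG γH γtG γtH ρG ρH γR
           ((S , domS , refl) , _) ((T , domT , refl) , _)
           ((DG , tdG , refl) , _) ((DH , tdH , refl) , γtH-min)
           ((B , opB , refl) , _) _
           γR-min@((f , rd , refl) , _) =
  ≤-trans (m⊓n≤m _ _) (∣B∣*γt≤weight G H noH rd opB γtH-min) ,
  ⊓-glb (roman≤2*γt*γt G H γR-min tdG tdH) (roman≤6*γ*γ G H noG noH γR-min domS domT)
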